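{- If $m$ is an even positive integer, then every contiguous stepping sequence for $m$ begins and ends with an odd integer.
   Context: Let $n\ge1$ and start with nested sets $S_i=\{1,\ldots,i\}$, $0\le i\le n$. A move with index $i$ ($1\le i\le n-1$) replaces $S_i$ by $S_{i-1}\cup(S_{i+1}\setminus S_i)$; the set produced is the new $S_i$. A sequence $[i_1,\ldots,i_N]$ with entries in $\{1,\ldots,n-1\}$ is a stepping sequence for $n$ if the initial sets $S_0,\ldots,S_n$ together with the sets produced by the successive moves $i_1,\ldots,i_N$ contain every subset of $\{1,\ldots,n\}$ exactly once. A sequence of integers is contiguous if consecutive entries differ by $\pm1$. -}

module Defs where

open import Data.Bool using (Bool; true; false; if_then_else_)
open import Data.Unit using (⊤)
open import Data.Nat using (ℕ; zero; suc; _+_; _∸_; _≤_; _<ᵇ_; _≡ᵇ_)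
open import Data.Fin using (Fin; toℕ)
open import Data.Fin.Subset using (Subset; _∪_; _─_)
open import Data.Vec using (tabulate)
open import Data.List using (List; []; _∷_; _++_; map; upTo)
open import Data.List.Relation.Unary.All using (All)
open import Data.List.Relation.Unary.Unique.Propositional using (Unique)
open import Data.List.Membership.Propositional using (_∈_)
open import Data.Product using (_×_)
open import Data.Sum using (_⊎_)
open import Relation.Binary.PropositionalEquality using (_≡_)

-- A configuration: S i for i = 0,…,n (values at indices > n are irrelevant).
-- Subsets of {1,…,n} are Subset n; Fin index j stands for the element j+1.
Config : ℕ → Set
Config n = ℕ → Subset n

-- Initial sets S_i = {1,…,i}: element j+1 ∈ S_i iff j < i.
initial : (n : ℕ) → Config n
initial n i = tabulate (λ j → toℕ j <ᵇ i)

produced : ∀ {n} → Config n → ℕ → Subset n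
produced S i = S (i ∸ 1) ∪ (S (suc i) ─ S i)

move : ∀ {n} → Config n → ℕ → Config n
move S i k = if k ≡ᵇ i then produced S i else S k

producedSets : ∀ {n} → Config n → List ℕ → List (Subset n)
producedSets S []       = []
producedSets S (i ∷ is) = produced S i ∷ producedSets (move S i) is

allSets : (n : ℕ) → List ℕ → List (Subset n)
allSets n is = map (initial n) (upTo (suc n)) ++ producedSets (initial n) is

IsSteppingSequence : ℕ → List ℕ → Set
IsSteppingSequence n is =
  All (λ i → 1 ≤ i × suc i ≤ n) is
  × Unique (allSets n is)
  × (∀ (s : Subset n) → s ∈ allSets n is)

Contiguous : List ℕ → Set
Contiguous []           = ⊤
Contiguous (x ∷ [])     = ⊤
Contiguous (x ∷ y ∷ xs) = (y ≡ suc x ⊎ x ≡ suc y) × Contiguous (y ∷ xs)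

module Submission where

-- Throughout any sequence of moves the sets form a complete
-- flag  ∅ = S₀ ⋖ S₁ ⋖ ⋯ ⋖ Sₘ  (each Sₖ₊₁ adds exactly one element to Sₖ):
-- a move at i replaces Sᵢ by  Sᵢ₋₁ ∪ (Sᵢ₊₁ ─ Sᵢ),  which again lies strictly
-- between Sᵢ₋₁ and Sᵢ₊₁ (the exchange lemma).  Hence |Sₖ| = k always, and the
-- set produced by a move with index i has exactly i elements.  So the sizes of
-- the listed sets are  0, 1, …, m, i₁, …, i_N.
--
-- Weigh a size k by (-1)^k and let the balance of a list be the sum of the
-- weights.  A stepping sequence lists every subset exactly once, and the subsets
-- of a nonempty set have balance 0; the initial sizes 0, …, m have balance 1
-- when m is even.  So a stepping sequence has balance -1.  A contiguous
-- sequence alternates in parity, so its balance is its first weight (and its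
-- last weight equals its first) or 0.  Balance -1 therefore forces both the
-- first and the last entry to be odd.

open import Defs
open import Data.Nat using (ℕ; _≤_)
open import Data.Nat.Divisibility using (_∣_)
open import Data.List using (List; _∷_; _∷ʳ_)
open import Data.Product using (_×_; ∃-syntax)
open import Relation.Binary.PropositionalEquality using (_≡_)
open import Relation.Nullary using (¬_)

open import Data.Bool using (Bool; true; false; not; _∧_; _∨_)
open import Data.Bool.Properties using (T-≡; ∨-identityʳ)
open import Data.Fin using (toℕ)
open import Data.Fin.Subset using (Subset; _∪_; _─_; ∣_∣)
open import Data.Integer using (ℤ; 0ℤ; 1ℤ; -1ℤ; -_; _+_)
open import Data.Integer.Properties
  using (+-assoc; +-identityˡ; +-identityʳ; +-inverseˡ; +-inverseʳ; neg-involutive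
        ; neg-distrib-+; +-0-isCommutativeMonoid)
open import Data.List using ([]; _++_; map; foldr; upTo)
open import Data.List.Properties using (map-++; map-∘; map-id; map-applyUpTo; map-cong-local)
open import Data.List.Membership.Propositional using (_∈_)
open import Data.List.Membership.Propositional.Properties using (∈-map⁺; ∈-map⁻; ∈-++⁺ˡ; ∈-++⁺ʳ)
open import Data.List.Membership.Propositional.Properties.WithK using (unique∧set⇒bag)
open import Data.List.Relation.Binary.BagAndSetEquality using (∼bag⇒↭)
open import Data.List.Relation.Binary.Permutation.Propositional using (_↭_; ↭⇒↭ₛ)
open import Data.List.Relation.Binary.Permutation.Propositional.Properties using (map⁺)
open import Data.List.Relation.Binary.Permutation.Setoid.Properties using (foldr-commMonoid)
open import Data.List.Relation.Unary.All using (All; []; _∷_)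
open import Data.List.Relation.Unary.All.Properties using (applyUpTo⁺₁)
open import Data.List.Relation.Unary.Any using (here)
open import Data.List.Relation.Unary.AllPairs using ([]; _∷_)
open import Data.List.Relation.Unary.Unique.Propositional using (Unique)
import Data.List.Relation.Unary.Unique.Propositional.Properties as Unique
open import Data.Nat using (zero; suc; _*_; _≡ᵇ_; _<ᵇ_; _≟_; s≤s; z≤n)
open import Data.Nat.Divisibility using (divides)
open import Data.Nat.Properties using (≡⇒≡ᵇ; ≡ᵇ⇒≡; ≤-trans; n≤1+n; ≤-pred)
open import Data.Product using (_,_; proj₁; proj₂)
open import Data.Sum using (_⊎_; inj₁; inj₂)
open import Data.Vec using ([]; _∷_; tabulate; zipWith)
open import Data.Vec.Properties using (∷-injectiveʳ)
open import Function.Bundles using (mk⇔; Equivalence)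
open import Relation.Binary.PropositionalEquality
  using (refl; sym; trans; cong; cong₂; _≢_; setoid; module ≡-Reasoning)
open import Relation.Nullary using (yes; no; contradiction)

open ≡-Reasoning

private
  variable
    n m : ℕ
    A B C : Subset n

data _⋖_ : Subset n → Subset n → Set where
  added : {v : Subset n} → (false ∷ v) ⋖ (true ∷ v)
  keep  : {v w : Subset n} (x : Bool) → v ⋖ w → (x ∷ v) ⋖ (x ∷ w)

between : ∀ {X Y : Subset n} → A ⋖ X → X ⋖ C → Y ≡ X → A ⋖ Y × Y ⋖ C
between A⋖X X⋖C refl = A⋖X , X⋖C

⋖-size : A ⋖ B → ∣ B ∣ ≡ suc ∣ A ∣
⋖-size added          = refl
⋖-size (keep true p)  = cong suc (⋖-size p)
⋖-size (keep false p) = ⋖-size p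

zipWith-cong : ∀ {f g : Bool → Bool → Bool} → (∀ a b → f a b ≡ g a b) →
               (p q : Subset n) → zipWith f p q ≡ zipWith g p q
zipWith-cong f≗g []      []      = refl
zipWith-cong f≗g (a ∷ p) (b ∷ q) = cong₂ _∷_ (f≗g a b) (zipWith-cong f≗g p q)

─-∷ : ∀ x y (p q : Subset n) → (x ∷ p) ─ (y ∷ q) ≡ (not y ∧ x) ∷ (p ─ q)
─-∷ x true  p q = cong (false ∷_) (zipWith-cong (λ { _ true → refl ; _ false → refl }) p q)
─-∷ x false p q = cong (x ∷_) (zipWith-cong (λ { _ true → refl ; _ false → refl }) p q)

∪-─-∷ : ∀ x y z (A B C : Subset n) →
        (x ∷ A) ∪ ((z ∷ C) ─ (y ∷ B)) ≡ (x ∨ (not y ∧ z)) ∷ (A ∪ (C ─ B))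
∪-─-∷ x y z A B C = cong ((x ∷ A) ∪_) (─-∷ z y C B)

∨-not-∧-self : ∀ x y → x ∨ (not y ∧ y) ≡ x
∨-not-∧-self x true  = ∨-identityʳ x
∨-not-∧-self x false = ∨-identityʳ x

∪-─-self : (A B : Subset n) → A ∪ (B ─ B) ≡ A
∪-─-self []      []      = refl
∪-─-self (x ∷ A) (y ∷ B) =
  trans (∪-─-∷ x y y A B B) (cong₂ _∷_ (∨-not-∧-self x y) (∪-─-self A B))

⋖-∪-─ : A ⋖ B → A ∪ (B ─ A) ≡ B
⋖-∪-─ {A = false ∷ A} added =
  trans (∪-─-∷ false false true A A A) (cong (true ∷_) (∪-─-self A A))
⋖-∪-─ {A = x ∷ A} {B = x ∷ B} (keep x p) =
  trans (∪-─-∷ x x x A A B) (cong₂ _∷_ (∨-not-∧-self x x) (⋖-∪-─ p))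

-- Exchange lemma: in a chain A ⋖ B ⋖ C the set A ∪ (C ─ B) (which adds to A
-- the element that C adds to B) is the other set lying between A and C.
exchange : A ⋖ B → B ⋖ C → A ⋖ (A ∪ (C ─ B)) × (A ∪ (C ─ B)) ⋖ C
exchange {A = false ∷ A} {C = true ∷ C} added (keep true q) =
  between (keep false q) added
    (trans (∪-─-∷ false true true A A C) (cong (false ∷_) (⋖-∪-─ q)))
exchange {A = false ∷ A} {B = false ∷ B} (keep false p) added =
  between added (keep true p)
    (trans (∪-─-∷ false false true A B B) (cong (true ∷_) (∪-─-self A B)))
exchange {A = x ∷ A} {B = x ∷ B} {C = x ∷ C} (keep x p) (keep x q) =
  let r , s = exchange p q in
  between (keep x r) (keep x s)
    (trans (∪-─-∷ x x x A B C) (cong (_∷ (A ∪ (C ─ B))) (∨-not-∧-self x x)))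

IsFlag : (m : ℕ) → Config m → Set
IsFlag m S = ∣ S 0 ∣ ≡ 0 × (∀ k → suc k ≤ m → S k ⋖ S (suc k))

flag-size : ∀ {S : Config m} → IsFlag m S → ∀ k → k ≤ m → ∣ S k ∣ ≡ k
flag-size (empty , _)     zero    _  = empty
flag-size flag@(_ , cover) (suc k) k<m =
  trans (⋖-size (cover k k<m)) (cong suc (flag-size flag k (≤-trans (n≤1+n k) k<m)))

initial-flag : ∀ m → IsFlag m (initial m)
initial-flag m = empty m , cover m
  where
  empty : ∀ n → ∣ tabulate {n = n} (λ j → toℕ j <ᵇ 0) ∣ ≡ 0
  empty zero    = refl
  empty (suc n) = empty n
  cover : ∀ n k → suc k ≤ n →
          tabulate {n = n} (λ j → toℕ j <ᵇ k) ⋖ tabulate (λ j → toℕ j <ᵇ suc k)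
  cover (suc n) zero    _         = added
  cover (suc n) (suc k) (s≤s k<n) = keep true (cover n k k<n)

move-here : (S : Config m) (i : ℕ) → move S i i ≡ produced S i
move-here S i rewrite Equivalence.to T-≡ (≡⇒≡ᵇ i i refl) = refl

move-elsewhere : (S : Config m) {i k : ℕ} → k ≢ i → move S i k ≡ S k
move-elsewhere S {i} {k} k≢i with k ≡ᵇ i in eq
... | false = refl
... | true  = contradiction (≡ᵇ⇒≡ k i (Equivalence.from T-≡ eq)) k≢i

produced-between : ∀ {S : Config m} i → suc (suc i) ≤ m → IsFlag m S →
                   S i ⋖ produced S (suc i) × produced S (suc i) ⋖ S (suc (suc i))
produced-between i i<m (_ , cover) =
  exchange (cover i (≤-trans (n≤1+n (suc i)) i<m)) (cover (suc i) i<m)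

-- Moves preserve complete flags: the produced set fits between its
-- neighbours, and all other links of the chain are untouched.
move-flag : ∀ {S : Config m} i → suc (suc i) ≤ m → IsFlag m S → IsFlag m (move S (suc i))
move-flag {m} {S} i i<m flag@(empty , cover) = empty , cover′
  where
  cover′ : ∀ k → suc k ≤ m → move S (suc i) k ⋖ move S (suc i) (suc k)
  cover′ k k<m with k ≟ suc i | suc k ≟ suc i
  ... | yes refl | _ rewrite move-here S (suc i) | move-elsewhere S {suc i} {suc (suc i)} (λ ())
    = proj₂ (produced-between i i<m flag)
  ... | no k≢i | yes refl rewrite move-here S (suc k) | move-elsewhere S k≢i
    = proj₁ (produced-between i i<m flag)
  ... | no k≢i | no sk≢i rewrite move-elsewhere S k≢i | move-elsewhere S sk≢i
    = cover k k<m

-- The set produced by a move with index i in a complete flag has i elements: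
-- it covers S (i - 1), which has i - 1 elements.
produced-size : ∀ {S : Config m} i → suc (suc i) ≤ m → IsFlag m S →
                ∣ produced S (suc i) ∣ ≡ suc i
produced-size i i<m flag =
  trans (⋖-size (proj₁ (produced-between i i<m flag)))
        (cong suc (flag-size flag i (≤-trans (n≤1+n i) (≤-trans (n≤1+n (suc i)) i<m))))

producedSets-sizes : ∀ {S : Config m} is → All (λ i → 1 ≤ i × suc i ≤ m) is → IsFlag m S →
                     map ∣_∣ (producedSets S is) ≡ is
producedSets-sizes []            []                     flag = refl
producedSets-sizes (suc i ∷ is) ((s≤s z≤n , i<m) ∷ ok) flag =
  cong₂ _∷_ (produced-size i i<m flag) (producedSets-sizes is ok (move-flag i i<m flag))

allSets-sizes : ∀ m is → All (λ i → 1 ≤ i × suc i ≤ m) is →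
                map ∣_∣ (allSets m is) ≡ upTo (suc m) ++ is
allSets-sizes m is ok = begin
  map ∣_∣ (allSets m is)
    ≡⟨ map-++ ∣_∣ (map (initial m) (upTo (suc m))) (producedSets (initial m) is) ⟩
  map ∣_∣ (map (initial m) (upTo (suc m))) ++ map ∣_∣ (producedSets (initial m) is)
    ≡⟨ cong₂ _++_ initial-sizes (producedSets-sizes is ok (initial-flag m)) ⟩
  upTo (suc m) ++ is ∎
  where
  initial-sizes : map ∣_∣ (map (initial m) (upTo (suc m))) ≡ upTo (suc m)
  initial-sizes = begin
    map ∣_∣ (map (initial m) (upTo (suc m)))  ≡⟨ map-∘ (upTo (suc m)) ⟨
    map (λ k → ∣ initial m k ∣) (upTo (suc m))
      ≡⟨ map-cong-local (applyUpTo⁺₁ (λ k → k) (suc m)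
                           (λ k<m → flag-size (initial-flag m) _ (≤-pred k<m))) ⟩
    map (λ k → k) (upTo (suc m))               ≡⟨ map-id (upTo (suc m)) ⟩
    upTo (suc m) ∎

subsets : ∀ n → List (Subset n)
subsets zero    = [] ∷ []
subsets (suc n) = map (true ∷_) (subsets n) ++ map (false ∷_) (subsets n)

subsets-complete : (s : Subset n) → s ∈ subsets n
subsets-complete []                = here refl
subsets-complete {suc n} (true ∷ s)  = ∈-++⁺ˡ (∈-map⁺ (true ∷_) (subsets-complete s))
subsets-complete {suc n} (false ∷ s) =
  ∈-++⁺ʳ (map (true ∷_) (subsets n)) (∈-map⁺ (false ∷_) (subsets-complete s))

subsets-unique : ∀ n → Unique (subsets n)
subsets-unique zero    = [] ∷ []
subsets-unique (suc n) =
  Unique.++⁺ (Unique.map⁺ ∷-injectiveʳ (subsets-unique n))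
             (Unique.map⁺ ∷-injectiveʳ (subsets-unique n)) disjoint
  where
  disjoint : ∀ {s} → ¬ (s ∈ map (true ∷_) (subsets n) × s ∈ map (false ∷_) (subsets n))
  disjoint (p , q) with ∈-map⁻ (true ∷_) p | ∈-map⁻ (false ∷_) q
  ... | _ , _ , refl | _ , _ , ()

stepping-↭ : ∀ m is → IsSteppingSequence m is → allSets m is ↭ subsets m
stepping-↭ m is (_ , unique , complete) =
  ∼bag⇒↭ (unique∧set⇒bag unique (subsets-unique m)
           (mk⇔ (λ _ → subsets-complete _) (λ _ → complete _)))

sign : ℕ → ℤ
sign zero    = 1ℤ
sign (suc k) = - sign k

balance : List ℕ → ℤ
balance xs = foldr _+_ 0ℤ (map sign xs)

balance-++ : ∀ xs ys → balance (xs ++ ys) ≡ balance xs + balance ys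
balance-++ []       ys = sym (+-identityˡ (balance ys))
balance-++ (x ∷ xs) ys = begin
  sign x + balance (xs ++ ys)          ≡⟨ cong (sign x +_) (balance-++ xs ys) ⟩
  sign x + (balance xs + balance ys)   ≡⟨ +-assoc (sign x) (balance xs) (balance ys) ⟨
  (sign x + balance xs) + balance ys   ∎

balance-↭ : ∀ {xs ys} → xs ↭ ys → balance xs ≡ balance ys
balance-↭ p = foldr-commMonoid (setoid ℤ) +-0-isCommutativeMonoid (↭⇒↭ₛ (map⁺ sign p))

balance-map-suc : ∀ xs → balance (map suc xs) ≡ - balance xs
balance-map-suc []       = refl
balance-map-suc (x ∷ xs) = begin
  - sign x + balance (map suc xs)  ≡⟨ cong (- sign x +_) (balance-map-suc xs) ⟩
  - sign x + - balance xs          ≡⟨ neg-distrib-+ (sign x) (balance xs) ⟨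
  - (sign x + balance xs)          ∎

-- A nonempty set has as many subsets of even size as of odd size: adding the
-- first element is a parity-flipping bijection between the two halves.
subsets-balance : ∀ n → balance (map ∣_∣ (subsets (suc n))) ≡ 0ℤ
subsets-balance n = begin
  balance (map ∣_∣ (map (true ∷_) S ++ map (false ∷_) S))
    ≡⟨ cong balance (map-++ ∣_∣ (map (true ∷_) S) (map (false ∷_) S)) ⟩
  balance (map ∣_∣ (map (true ∷_) S) ++ map ∣_∣ (map (false ∷_) S))
    ≡⟨ cong₂ (λ xs ys → balance (xs ++ ys)) (trans (sym (map-∘ S)) (map-∘ S)) (sym (map-∘ S)) ⟩
  balance (map suc (map ∣_∣ S) ++ map ∣_∣ S)
    ≡⟨ balance-++ (map suc (map ∣_∣ S)) (map ∣_∣ S) ⟩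
  balance (map suc (map ∣_∣ S)) + balance (map ∣_∣ S)
    ≡⟨ cong (_+ balance (map ∣_∣ S)) (balance-map-suc (map ∣_∣ S)) ⟩
  - balance (map ∣_∣ S) + balance (map ∣_∣ S)
    ≡⟨ +-inverseˡ (balance (map ∣_∣ S)) ⟩
  0ℤ ∎
  where
  S : List (Subset n)
  S = subsets n

upTo-balance : ∀ q → balance (upTo (suc (q * 2))) ≡ 1ℤ
upTo-balance zero    = refl
upTo-balance (suc q) = begin
  balance (upTo (suc (suc (suc (q * 2)))))  ≡⟨ prepend-zero (suc (suc (q * 2))) ⟩
  1ℤ + - balance (upTo (suc (suc (q * 2)))) ≡⟨ cong (λ b → 1ℤ + - b) (prepend-zero (suc (q * 2))) ⟩
  1ℤ + - (1ℤ + - b)                          ≡⟨ cong (1ℤ +_) (neg-distrib-+ 1ℤ (- b)) ⟩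
  1ℤ + (-1ℤ + - - b)                         ≡⟨ +-assoc 1ℤ -1ℤ (- - b) ⟨
  0ℤ + - - b                                 ≡⟨ +-identityˡ (- - b) ⟩
  - - b                                      ≡⟨ neg-involutive b ⟩
  b                                          ≡⟨ upTo-balance q ⟩
  1ℤ ∎
  where
  b : ℤ
  b = balance (upTo (suc (q * 2)))
  -- 0, 1, …, k is 0 followed by the shifted list 0, …, k - 1.
  prepend-zero : ∀ k → balance (upTo (suc k)) ≡ 1ℤ + - balance (upTo k)
  prepend-zero k = begin
    balance (upTo (suc k))           ≡⟨ cong (λ xs → 1ℤ + balance xs) (map-applyUpTo (λ i → i) suc k) ⟨
    1ℤ + balance (map suc (upTo k))  ≡⟨ cong (1ℤ +_) (balance-map-suc (upTo k)) ⟩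
    1ℤ + - balance (upTo k)          ∎

sign-even : ∀ q → sign (q * 2) ≡ 1ℤ
sign-even zero    = refl
sign-even (suc q) = trans (neg-involutive (sign (q * 2))) (sign-even q)

odd-if-negative : ∀ x → sign x ≡ -1ℤ → ¬ (2 ∣ x)
odd-if-negative _ negative (divides q refl) =
  contradiction (trans (sym (sign-even q)) negative) λ ()

neighbour-sign : ∀ {x y} → y ≡ suc x ⊎ x ≡ suc y → sign y ≡ - sign x
neighbour-sign           (inj₁ refl) = refl
neighbour-sign {y = y}   (inj₂ refl) = sym (neg-involutive (sign y))

lastOf : ℕ → List ℕ → ℕ
lastOf x []       = x
lastOf _ (y ∷ ys) = lastOf y ys

lastOf-∷ʳ : ∀ x xs → ∃[ front ] (x ∷ xs ≡ front ∷ʳ lastOf x xs)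
lastOf-∷ʳ x []       = [] , refl
lastOf-∷ʳ x (y ∷ ys) = let front , eq = lastOf-∷ʳ y ys in x ∷ front , cong (x ∷_) eq

alternating-balance : ∀ x xs → Contiguous (x ∷ xs) →
  (balance (x ∷ xs) ≡ sign x × sign (lastOf x xs) ≡ sign x)
  ⊎ (balance (x ∷ xs) ≡ 0ℤ × sign (lastOf x xs) ≡ - sign x)
alternating-balance x []       _               = inj₁ (+-identityʳ (sign x) , refl)
alternating-balance x (y ∷ xs) (step , contig) with alternating-balance y xs contig
... | inj₁ (bal , end) = inj₂
  ( (begin
      sign x + balance (y ∷ xs)  ≡⟨ cong (sign x +_) (trans bal flip) ⟩
      sign x + - sign x          ≡⟨ +-inverseʳ (sign x) ⟩
      0ℤ                         ∎)
  , trans end flip )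
  where
  flip : sign y ≡ - sign x
  flip = neighbour-sign step
... | inj₂ (bal , end) = inj₁
  ( trans (cong (sign x +_) bal) (+-identityʳ (sign x))
  , trans end (trans (cong -_ (neighbour-sign step)) (neg-involutive (sign x))) )

negative-balance-ends-odd : ∀ is → Contiguous is → balance is ≡ -1ℤ →
  (∃[ a ] ∃[ rest ] (is ≡ a ∷ rest × ¬ (2 ∣ a)))
  × (∃[ front ] ∃[ z ] (is ≡ front ∷ʳ z × ¬ (2 ∣ z)))
negative-balance-ends-odd []       _      ()
negative-balance-ends-odd (x ∷ xs) contig negative with alternating-balance x xs contig
... | inj₁ (bal , end) =
  let front , split = lastOf-∷ʳ x xs
      first-negative = trans (sym bal) negative
  in (x , xs , refl , odd-if-negative x first-negative)
   , (front , lastOf x xs , split , odd-if-negative _ (trans end first-negative))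
... | inj₂ (zero-balance , _) = contradiction (trans (sym zero-balance) negative) λ ()

-- Counting sizes: for even m ≥ 1 the moves of a stepping sequence have balance
-- -1, since the initial sets contribute 1 and all subsets together contribute 0.
stepping-balance : ∀ m → 1 ≤ m → 2 ∣ m → ∀ is → IsSteppingSequence m is → balance is ≡ -1ℤ
stepping-balance m@(suc n) _ (divides q m≡2q) is stepping = begin
  balance is                     ≡⟨ +-identityˡ (balance is) ⟨
  (-1ℤ + 1ℤ) + balance is        ≡⟨ +-assoc -1ℤ 1ℤ (balance is) ⟩
  -1ℤ + (1ℤ + balance is)        ≡⟨ cong (-1ℤ +_) total ⟩
  -1ℤ                            ∎
  where
  total : 1ℤ + balance is ≡ 0ℤ
  total = begin
    1ℤ + balance is                        ≡⟨ cong (_+ balance is) initial-balance ⟨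
    balance (upTo (suc m)) + balance is    ≡⟨ balance-++ (upTo (suc m)) is ⟨
    balance (upTo (suc m) ++ is)           ≡⟨ cong balance (allSets-sizes m is (proj₁ stepping)) ⟨
    balance (map ∣_∣ (allSets m is))       ≡⟨ balance-↭ (map⁺ ∣_∣ (stepping-↭ m is stepping)) ⟩
    balance (map ∣_∣ (subsets m))          ≡⟨ subsets-balance n ⟩
    0ℤ                                     ∎
    where
    initial-balance : balance (upTo (suc m)) ≡ 1ℤ
    initial-balance = trans (cong (λ k → balance (upTo (suc k))) m≡2q) (upTo-balance q)

lemma6p3 : ∀ (m : ℕ) → 1 ≤ m → 2 ∣ m → ∀ (is : List ℕ) →
           IsSteppingSequence m is → Contiguous is →
           (∃[ a ] ∃[ rest ] (is ≡ a ∷ rest × ¬ (2 ∣ a)))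
           × (∃[ front ] ∃[ z ] (is ≡ front ∷ʳ z × ¬ (2 ∣ z)))
lemma6p3 m 1≤m 2∣m is stepping contig =
  negative-balance-ends-odd is contig (stepping-balance m 1≤m 2∣m is stepping)
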